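{- Let $F$ be a field and let $d\ge 3$ and $1\le t\le d-1$ be integers such that $d-t$ divides $d+1$. Then $0\le \mathrm{M}(C_{d+1}^{(d)}(t))\le \mathrm{Z}_0(C_{d+1}^{(d)}(t))=1$.
   Context: For integers $d\ge3$, $1\le t\le d-1$ and $s\ge \frac{d+1}{d-t}$, the $t$-tight circular-arc $d$-hypergraph $C_n^{(d)}(t)$ has vertex set $[n]$ with $n=s(d-t)$ and edges $e_i=\{\ell_i,\ell_i+1,\dots,\ell_i+d-1\}$ for $\ell_i=(i-1)(d-t)+1$, $i=1,\dots,s$, where $n+k$ is interpreted as $k$. (Here $n=d+1$, i.e., $s=\frac{d+1}{d-t}$.) $\mathrm{M}(H)$: a $d$-hypermatrix $A=[a_{i_1\cdots i_d}]\in F^{n\times\cdots\times n}$ is graphical if symmetric under all permutations of indices and $a_{i_1\cdots i_d}=0$ whenever the indices are not all distinct; $\mathcal{S}(H)$ is the set of graphical $A$ with $a_{i_1\cdots i_d}\ne0$ iff $\{i_1,\dots,i_d\}\in E(H)$. $x\in F^n$ is a null vector of $A$ if $\sum_{j=1}^n a_{i_1\cdots i_{d-1}j}x_j=0$ for all $(i_1,\dots,i_{d-1})\in[n]^{d-1}$; $\operatorname{null}A$ is the dimension of the null space, $\mathrm{M}(H)=\max\{\operatorname{null}A:A\in\mathcal{S}(H)\}$. $\mathrm{Z}_0(H)$: with a set $B$ initially blue, others white, a set $S$ of $d-1$ distinct vertices (not necessarily blue) can turn a white $w$ blue if $S\cup\{w\}\in E(H)$ and every white $u$ with $S\cup\{u\}\in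 E(H)$ equals $w$. $\mathrm{Z}_0(H)$ is the minimum size of a set $B$ from which repeated application colors all vertices blue. -}

module Defs where

open import Level using (Level; suc; _⊔_)
open import Algebra.Bundles using (CommutativeRing)
import Algebra.Definitions.RawMonoid as RawMonoidDefs
import Data.Nat as ℕ
open ℕ using (ℕ; _∸_; _<_; _≤_)
open import Data.Fin using (Fin; toℕ; _≟_)
open import Data.Fin.Subset using (Subset; _∈_; _∉_; _∪_; ⁅_⁆; ∣_∣; ⊤)
open import Data.Fin.Permutation using (Permutation′; _⟨$⟩ʳ_)
open import Data.Product using (Σ; ∃; ∃-syntax; _×_; _,_)
open import Data.Sum using (_⊎_)
open import Function using (_∘_; _⇔_; Injective)
open import Relation.Binary.PropositionalEquality using (_≡_)
open import Relation.Binary.Construct.Closure.ReflexiveTransitive using (Star)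
open import Relation.Nullary using (¬_)

record Field (c ℓ : Level) : Set (Level.suc (c ⊔ ℓ)) where
  field
    commutativeRing : CommutativeRing c ℓ
  open CommutativeRing commutativeRing public
  field
    1≉0     : ¬ (1# ≈ 0#)
    inverse : ∀ x → ¬ (x ≈ 0#) → ∃[ y ] (x * y ≈ 1#)

record Hypergraph (n : ℕ) : Set₁ where
  field
    EdgeIx : Set
    _∈ₑ_   : Fin n → EdgeIx → Set

_∈E_ : ∀ {n} → (Fin n → Set) → Hypergraph n → Set
X ∈E H = ∃[ e ] (∀ v → X v ⇔ (v ∈ₑ e))
  where open Hypergraph H

-- Vertices 0,…,n-1 (vertex k here is vertex k+1 of the paper).
-- Edge i (i = 0,…,s-1) is {ℓ_i, ℓ_i + 1, …, ℓ_i + d - 1} with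
-- ℓ_i = i(d - t), read cyclically modulo n (n + k is interpreted as k).

circArc : (d t s : ℕ) → Hypergraph (s ℕ.* (d ∸ t))
circArc d t s = record
  { EdgeIx = Fin s
  ; _∈ₑ_   = λ v i → ∃[ k ] (k < d ×
               ((toℕ v ≡ toℕ i ℕ.* (d ∸ t) ℕ.+ k)
                ⊎ (toℕ v ℕ.+ s ℕ.* (d ∸ t) ≡ toℕ i ℕ.* (d ∸ t) ℕ.+ k)))
  }

module _ {c ℓ} (F : Field c ℓ) where
  open Field F
  open RawMonoidDefs +-rawMonoid using (sum)

  Hypermatrix : ℕ → ℕ → Set c
  Hypermatrix d n = (Fin d → Fin n) → Carrier

  replaceAt : ∀ {d n} → (Fin d → Fin n) → Fin d → Fin n → (Fin d → Fin n)
  replaceAt ι p j q with p ≟ q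
  ... | Relation.Nullary.yes _ = j
  ... | Relation.Nullary.no  _ = ι q

  Graphical : ∀ {d n} → Hypermatrix d n → Set ℓ
  Graphical {d} {n} A =
    (∀ (σ : Permutation′ d) (ι : Fin d → Fin n) → A (ι ∘ (σ ⟨$⟩ʳ_)) ≈ A ι)
    × (∀ (ι : Fin d → Fin n) → ¬ Injective _≡_ _≡_ ι → A ι ≈ 0#)

  InS : ∀ {d n} → Hypergraph n → Hypermatrix d n → Set ℓ
  InS {d} {n} H A =
    Graphical A
    × (∀ (ι : Fin d → Fin n) →
         (¬ (A ι ≈ 0#)) ⇔ ((λ v → ∃[ p ] (ι p ≡ v)) ∈E H))

  -- x is a null vector of A: for all (i_1,…,i_{d-1}),
  -- ∑_j a_{i_1⋯i_{d-1} j} x_j = 0  (the last index is summed over)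
  NullVector : ∀ {d n} → Hypermatrix d n → (Fin n → Carrier) → Set ℓ
  NullVector {d} {n} A x =
    ∀ (ι : Fin d → Fin n) (p : Fin d) → toℕ p ≡ d ∸ 1 →
      sum (λ j → A (replaceAt ι p j) * x j) ≈ 0#

  LinearlyIndependent : ∀ {k n} → (Fin k → Fin n → Carrier) → Set (c ⊔ ℓ)
  LinearlyIndependent {k} {n} v =
    ∀ (a : Fin k → Carrier) →
      (∀ j → sum (λ i → a i * v i j) ≈ 0#) → ∀ i → a i ≈ 0#

  -- null A ≤ m: every linearly independent family of null vectors
  -- of A has at most m members (the dimension of the null space
  -- is the maximum size of a linearly independent family in it)
  NullityAtMost : ∀ {d n} → Hypermatrix d n → ℕ → Set (c ⊔ ℓ)
  NullityAtMost {d} {n} A m =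
    ∀ {k} (v : Fin k → Fin n → Carrier) →
      (∀ i → NullVector A (v i)) → LinearlyIndependent v → k ≤ m

  MaxNullityAtMost : ∀ d {n} → Hypergraph n → ℕ → Set (c ⊔ ℓ)
  MaxNullityAtMost d H m =
    ∀ (A : Hypermatrix d _) → InS H A → NullityAtMost A m

  -- S(H) is nonempty, so M(H) is a well-defined number ≥ 0
  SNonempty : ∀ d {n} → Hypergraph n → Set (c ⊔ ℓ)
  SNonempty d H = ∃[ A ] InS {d} H A

module _ (d : ℕ) {n : ℕ} (H : Hypergraph n) where

  Forces : Subset n → Subset n → Fin n → Set
  Forces C S w =
    ∣ S ∣ ≡ d ∸ 1
    × w ∉ C
    × (λ v → v ∈ S ⊎ v ≡ w) ∈E H
    × (∀ u → u ∉ C → (λ v → v ∈ S ⊎ v ≡ u) ∈E H → u ≡ w)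

  Step : Subset n → Subset n → Set
  Step C C′ = ∃[ S ] ∃[ w ] (Forces C S w × C′ ≡ C ∪ ⁅ w ⁆)

  ZeroForcingSet : Subset n → Set
  ZeroForcingSet B = Star Step B ⊤

  IsZ₀ : ℕ → Set
  IsZ₀ z = (∃[ B ] (∣ B ∣ ≡ z × ZeroForcingSet B))
           × (∀ B → ZeroForcingSet B → z ≤ ∣ B ∣)

module Submission where

-- Since d - t divides d + 1, each arc of length d on the (d+1)-cycle misses exactly one vertex, so
-- every edge of C_{d+1}^{(d)}(t) is the complement of a single vertex; the argument works for any
-- such hypergraph. The 0/1 indicator of the edges lies in S(H). If A ∈ S(H) and L is the vertex
-- missed by some edge, then for every other vertex v the null-vector equation at the tuple listing
-- all vertices but L and v has just two nonzero terms, c x_L + c' x_v = 0 with c' ≠ 0; so a null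
-- vector is determined by x_L and the null space is at most a line. Finally {L} is zero forcing
-- (with L blue, the vertices other than w and L force any white w), whereas a vertex missed by some
-- edge can never be forced, so the empty set is not.

open import Defs
open import Level using (Level)
open import Data.Bool using (if_then_else_)
open import Data.Empty using (⊥-elim)
open import Data.Nat as ℕ using (ℕ; zero; suc; _∸_; _≤_; _<_; z≤n; s≤s)
import Data.Nat.Properties as ℕ
open import Data.Fin as Fin using (Fin; toℕ; fromℕ; fromℕ<; punchIn; punchOut)
  renaming (zero to fz; suc to fs)
import Data.Fin.Properties as Fin
open import Data.Fin.Subset using (Subset; _∈_; _∉_; _⊆_; _∪_; ⁅_⁆; ∣_∣; ⊤; ∁)
open import Data.Fin.Subset.Properties
open import Data.Fin.Permutation using (_⟨$⟩ʳ_; _⟨$⟩ˡ_; inverseʳ)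
open import Data.List using (List; []; _∷_; foldl; allFin)
open import Data.List.Membership.Propositional using () renaming (_∈_ to _∈ₗ_)
open import Data.List.Membership.Propositional.Properties using (∈-allFin)
open import Data.List.Relation.Unary.Any using (here; there)
open import Data.Product using (∃-syntax; _×_; _,_; proj₁; proj₂)
open import Data.Sum using (_⊎_; inj₁; inj₂; [_,_])
open import Data.Vec.Functional using (insertAt)
open import Data.Vec.Functional.Properties using (insertAt-lookup; insertAt-punchIn)
open import Function using (_∘_; id; _⇔_; mk⇔; Injective)
open import Function.Bundles using (module Equivalence)
import Function.Properties.Equivalence as ⇔
open import Relation.Binary.PropositionalEquality
  using (_≡_; _≢_; refl; sym; trans; cong; subst; subst₂)
open import Relation.Binary.Construct.Closure.ReflexiveTransitive using (Star; ε; _◅_; _◅◅_)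
open import Relation.Nullary using (¬_; Dec; yes; no; does; contradiction)
open import Relation.Nullary.Decidable as Dec using (decidable-stable; does-⇔; map′; ¬?; _×-dec_; _→-dec_)

open Equivalence using (to; from)

∀-punchIn : ∀ {n p} (P : Fin (suc n) → Set p) i →
  P i → (∀ j → P (punchIn i j)) → ∀ j → P j
∀-punchIn P i Pi P↑ j with i Fin.≟ j
... | yes refl = Pi
... | no i≢j = subst P (Fin.punchIn-punchOut i≢j) (P↑ (punchOut i≢j))

injective⇒onto : ∀ {m} {f : Fin m → Fin m} → Injective _≡_ _≡_ f →
  ∀ z → ∃[ y ] (f y ≡ z)
injective⇒onto {suc m} {f} f-injective z with Fin.any? (λ y → f y Fin.≟ z)
... | yes hit = hit
... | no f≢z = contradiction (Fin.injective⇒≤ g-injective) ℕ.1+n≰n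
  where
  g : Fin (suc m) → Fin m
  g y = punchOut {i = z} (λ z≡fy → f≢z (y , sym z≡fy))
  g-injective : Injective _≡_ _≡_ g
  g-injective eq = f-injective (Fin.punchOut-injective {i = z} _ _ eq)

ontoComplement⇒injective : ∀ {m} (ι : Fin m → Fin (suc m)) a →
  (∀ v → v ≢ a → ∃[ p ] (ι p ≡ v)) → Injective _≡_ _≡_ ι
ontoComplement⇒injective {m} ι a onto = ι-injective
  where
  section : Fin m → Fin m
  section y = proj₁ (onto (punchIn a y) (Fin.punchInᵢ≢i a y))
  ι∘section : ∀ y → ι (section y) ≡ punchIn a y
  ι∘section y = proj₂ (onto (punchIn a y) (Fin.punchInᵢ≢i a y))
  section-injective : Injective _≡_ _≡_ section
  section-injective {y} {y′} eq = Fin.punchIn-injective a y y′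
    (trans (sym (ι∘section y)) (trans (cong ι eq) (ι∘section y′)))
  ι-injective : Injective _≡_ _≡_ ι
  ι-injective {p} {q} ιp≡ιq
    with injective⇒onto section-injective p | injective⇒onto section-injective q
  ... | y , refl | y′ , refl = cong section (Fin.punchIn-injective a y y′
    (trans (sym (ι∘section y)) (trans ιp≡ιq (ι∘section y′))))

∣⁅x⁆∪⁅y⁆∣≡2 : ∀ {n} {x y : Fin n} → x ≢ y → ∣ ⁅ x ⁆ ∪ ⁅ y ⁆ ∣ ≡ 2
∣⁅x⁆∪⁅y⁆∣≡2 {x = fz} {fz} x≢y = contradiction refl x≢y
∣⁅x⁆∪⁅y⁆∣≡2 {x = fz} {fs y} _ = cong suc (trans (cong ∣_∣ (∪-identityˡ ⁅ y ⁆)) (∣⁅x⁆∣≡1 y))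
∣⁅x⁆∪⁅y⁆∣≡2 {x = fs x} {fz} _ = cong suc (trans (cong ∣_∣ (∪-identityʳ ⁅ x ⁆)) (∣⁅x⁆∣≡1 x))
∣⁅x⁆∪⁅y⁆∣≡2 {x = fs x} {fs y} x≢y = ∣⁅x⁆∪⁅y⁆∣≡2 (x≢y ∘ cong fs)

x∈∁⁅y⁆∪⁅z⁆⇔ : ∀ {n} {x y z : Fin n} → x ∈ ∁ (⁅ y ⁆ ∪ ⁅ z ⁆) ⇔ (x ≢ y × x ≢ z)
x∈∁⁅y⁆∪⁅z⁆⇔ {y = y} {z} = mk⇔
  (λ x∈∁ → (λ x≡y → x∈∁p⇒x∉p x∈∁ (x∈p∪q⁺ (inj₁ (from x∈⁅y⁆⇔x≡y x≡y))))
         , (λ x≡z → x∈∁p⇒x∉p x∈∁ (x∈p∪q⁺ (inj₂ (from x∈⁅y⁆⇔x≡y x≡z)))))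
  (λ (x≢y , x≢z) → x∉p⇒x∈∁p
    ([ x≢y ∘ x∈⁅y⁆⇒x≡y y , x≢z ∘ x∈⁅y⁆⇒x≡y z ] ∘ x∈p∪q⁻ ⁅ y ⁆ ⁅ z ⁆))

x∈p⇒p∪⁅x⁆≡p : ∀ {n} {x : Fin n} {p} → x ∈ p → p ∪ ⁅ x ⁆ ≡ p
x∈p⇒p∪⁅x⁆≡p {x = x} {p} x∈p = ⊆-antisym
  ([ id , (λ y∈⁅x⁆ → subst (_∈ p) (sym (x∈⁅y⁆⇒x≡y x y∈⁅x⁆)) x∈p) ] ∘ x∈p∪q⁻ p ⁅ x ⁆)
  (p⊆p∪q ⁅ x ⁆)

insertAll : ∀ {n} → Subset n → List (Fin n) → Subset n
insertAll = foldl (λ p x → p ∪ ⁅ x ⁆)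

∈-insertAll : ∀ {n} {x : Fin n} {p} xs → x ∈ p ⊎ x ∈ₗ xs → x ∈ insertAll p xs
∈-insertAll []       (inj₁ x∈p)         = x∈p
∈-insertAll (y ∷ xs) (inj₁ x∈p)         = ∈-insertAll xs (inj₁ (p⊆p∪q ⁅ y ⁆ x∈p))
∈-insertAll (y ∷ xs) (inj₂ (here refl)) = ∈-insertAll xs (inj₁ (q⊆p∪q _ ⁅ y ⁆ (x∈⁅x⁆ y)))
∈-insertAll (y ∷ xs) (inj₂ (there x∈xs)) = ∈-insertAll xs (inj₂ x∈xs)

insertAll-allFin : ∀ {n} (p : Subset n) → insertAll p (allFin n) ≡ ⊤
insertAll-allFin {n} p = ⊆-antisym ⊆⊤ (λ {x} _ → ∈-insertAll (allFin n) (inj₂ (∈-allFin x)))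

image : ∀ {m n} → (Fin m → Fin n) → Fin n → Set
image ι v = ∃[ p ] (ι p ≡ v)

∈E-cong : ∀ {n} {H : Hypergraph n} {X Y : Fin n → Set} →
  (∀ v → X v ⇔ Y v) → X ∈E H ⇔ Y ∈E H
∈E-cong X⇔Y = mk⇔
  (λ (e , X⇔e) → e , λ v → ⇔.trans (⇔.sym (X⇔Y v)) (X⇔e v))
  (λ (e , Y⇔e) → e , λ v → ⇔.trans (X⇔Y v) (Y⇔e v))

_⇔?_ : ∀ {a b} {A : Set a} {B : Set b} → Dec A → Dec B → Dec (A ⇔ B)
a? ⇔? b? = map′ (λ (f , g) → mk⇔ f g) (λ A⇔B → to A⇔B , from A⇔B)
  ((a? →-dec b?) ×-dec (b? →-dec a?))

module _ {c ℓ} (F : Field c ℓ) where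
  open Field F
    renaming (refl to ≈-refl; sym to ≈-sym; trans to ≈-trans; reflexive to ≈-reflexive)
  open import Algebra.Properties.CommutativeMonoid.Sum +-commutativeMonoid
    using (sum; sum-remove; sum-cong-≋; sum-replicate-zero)
  open import Algebra.Properties.Ring ring
    using (-‿distribˡ-*; -‿distribʳ-*; -‿injective; -0#≈0#; +-inverseʳ-unique)
  open import Algebra.Properties.CommutativeSemigroup *-commutativeSemigroup
    using (x∙yz≈y∙xz; xy∙z≈y∙xz; x∙yz≈yx∙z)
  open import Relation.Binary.Reasoning.Setoid setoid

  replaceAt-at : ∀ {d n} (ι : Fin d → Fin n) p k → replaceAt F ι p k p ≡ k
  replaceAt-at ι p k with p Fin.≟ p
  ... | yes _ = refl
  ... | no p≢p = contradiction refl p≢p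

  replaceAt-punchIn : ∀ {d n} (ι : Fin (suc d) → Fin n) p k c →
    replaceAt F ι p k (punchIn p c) ≡ ι (punchIn p c)
  replaceAt-punchIn ι p k c with p Fin.≟ punchIn p c
  ... | yes p≡ = contradiction (sym p≡) (Fin.punchInᵢ≢i p c)
  ... | no _ = refl

  sum-zero : ∀ {n} {f : Fin n → Carrier} → (∀ i → f i ≈ 0#) → sum f ≈ 0#
  sum-zero {n} f≈0 = ≈-trans (sum-cong-≋ f≈0) (sum-replicate-zero n)

  sum-twoTerms : ∀ {n} (f : Fin (suc (suc n)) → Carrier) a b →
    (∀ c → f (punchIn a (punchIn b c)) ≈ 0#) → sum f ≈ f a + f (punchIn a b)
  sum-twoTerms f a b rest≈0 = begin
    sum f                                                      ≈⟨ sum-remove {i = a} f ⟩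
    f a + sum (f ∘ punchIn a)                                  ≈⟨ +-congˡ (sum-remove {i = b} (f ∘ punchIn a)) ⟩
    f a + (f (punchIn a b) + sum (f ∘ punchIn a ∘ punchIn b))  ≈⟨ +-congˡ (+-congˡ (sum-zero rest≈0)) ⟩
    f a + (f (punchIn a b) + 0#)                               ≈⟨ +-congˡ (+-identityʳ _) ⟩
    f a + f (punchIn a b)                                      ∎

  solve-linear : ∀ {γ γ′ x y z} → γ * x + γ′ * y ≈ 0# → γ′ * z ≈ 1# → y ≈ - (γ * z) * x
  solve-linear {γ} {γ′} {x} {y} {z} relation γ′z≈1 = begin
    y                ≈⟨ *-identityˡ y ⟨
    1# * y           ≈⟨ *-congʳ γ′z≈1 ⟨
    (γ′ * z) * y     ≈⟨ xy∙z≈y∙xz γ′ z y ⟩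
    z * (γ′ * y)     ≈⟨ *-congˡ (+-inverseʳ-unique (γ * x) (γ′ * y) relation) ⟩
    z * - (γ * x)    ≈⟨ -‿distribʳ-* z _ ⟨
    - (z * (γ * x))  ≈⟨ -‿cong (x∙yz≈yx∙z z γ x) ⟩
    - ((γ * z) * x)  ≈⟨ -‿distribˡ-* (γ * z) x ⟩
    - (γ * z) * x    ∎

  collinear⇒≤1 : ∀ {k n} (v : Fin k → Fin n → Carrier) (μ : Fin k → Carrier) (u : Fin n → Carrier) →
    (∀ i j → v i j ≈ μ i * u j) → LinearlyIndependent F v → k ≤ 1
  collinear⇒≤1 {zero}        _ _ _ _ _ = z≤n
  collinear⇒≤1 {suc zero}    _ _ _ _ _ = s≤s z≤n
  collinear⇒≤1 {suc (suc k)} {n} v μ u v≈μu independent =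
    contradiction (independent first v₀≈0 fz) 1≉0
    where
    μ₀ = μ fz
    μ₁ = μ (fs fz)
    dependent first : Fin (suc (suc k)) → Carrier
    dependent fz           = μ₁
    dependent (fs fz)      = - μ₀
    dependent (fs (fs _))  = 0#
    first fz     = 1#
    first (fs _) = 0#
    zeroTail : ∀ {m} (w : Fin m → Fin n → Carrier) j → sum (λ i → 0# * w i j) ≈ 0#
    zeroTail w j = sum-zero (λ i → zeroˡ (w i j))
    dependence : ∀ j → sum (λ i → dependent i * v i j) ≈ 0#
    dependence j = begin
      μ₁ * v fz j + (- μ₀ * v (fs fz) j + sum (λ i → 0# * v (fs (fs i)) j))
        ≈⟨ +-cong (*-congˡ (v≈μu fz j))
                  (+-cong (*-congˡ (v≈μu (fs fz) j)) (zeroTail (v ∘ fs ∘ fs) j)) ⟩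
      μ₁ * (μ₀ * u j) + (- μ₀ * (μ₁ * u j) + 0#)
        ≈⟨ +-congˡ (+-identityʳ _) ⟩
      μ₁ * (μ₀ * u j) + - μ₀ * (μ₁ * u j)
        ≈⟨ +-congˡ (-‿distribˡ-* μ₀ _) ⟨
      μ₁ * (μ₀ * u j) + - (μ₀ * (μ₁ * u j))
        ≈⟨ +-congˡ (-‿cong (x∙yz≈y∙xz μ₀ μ₁ (u j))) ⟩
      μ₁ * (μ₀ * u j) + - (μ₁ * (μ₀ * u j))
        ≈⟨ -‿inverseʳ _ ⟩
      0# ∎
    μ₀≈0 : μ₀ ≈ 0#
    μ₀≈0 = -‿injective (≈-trans (independent dependent dependence (fs fz)) (≈-sym -0#≈0#))
    v₀≈0 : ∀ j → sum (λ i → first i * v i j) ≈ 0#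
    v₀≈0 j = begin
      1# * v fz j + sum (λ i → 0# * v (fs i) j)  ≈⟨ +-cong (*-identityˡ _) (zeroTail (v ∘ fs) j) ⟩
      v fz j + 0#                               ≈⟨ +-identityʳ _ ⟩
      v fz j                                    ≈⟨ v≈μu fz j ⟩
      μ₀ * u j                                  ≈⟨ *-congʳ μ₀≈0 ⟩
      0# * u j                                  ≈⟨ zeroˡ _ ⟩
      0#                                        ∎

  indicator-≉0⇔ : ∀ {P : Set} (P? : Dec P) → (¬ ((if does P? then 1# else 0#) ≈ 0#)) ⇔ P
  indicator-≉0⇔ (yes p) = mk⇔ (λ _ → p) (λ _ → 1≉0)
  indicator-≉0⇔ (no ¬p) = mk⇔ (λ ≉0 → contradiction ≈-refl ≉0) (λ p → contradiction p ¬p)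

  module _ {d n} (H : Hypergraph n) (edge? : ∀ (ι : Fin d → Fin n) → Dec (image ι ∈E H))
           (edge⇒injective : ∀ (ι : Fin d → Fin n) → image ι ∈E H → Injective _≡_ _≡_ ι) where

    indicator : Hypermatrix F d n
    indicator ι = if does (edge? ι) then 1# else 0#

    indicator∈S : InS F H indicator
    indicator∈S = (symmetric , vanishes) , λ ι → indicator-≉0⇔ (edge? ι)
      where
      symmetric : ∀ σ ι → indicator (ι ∘ (σ ⟨$⟩ʳ_)) ≈ indicator ι
      symmetric σ ι = ≈-reflexive (cong (λ b → if b then 1# else 0#)
        (does-⇔ (∈E-cong image⇔) (edge? (ι ∘ (σ ⟨$⟩ʳ_))) (edge? ι)))
        where
        image⇔ : ∀ v → image (ι ∘ (σ ⟨$⟩ʳ_)) v ⇔ image ι v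
        image⇔ v = mk⇔ (λ (p , eq) → σ ⟨$⟩ʳ p , eq)
                       (λ (p , eq) → σ ⟨$⟩ˡ p , trans (cong ι (inverseʳ σ)) eq)
      vanishes : ∀ ι → ¬ Injective _≡_ _≡_ ι → indicator ι ≈ 0#
      vanishes ι ¬injective with edge? ι
      ... | yes edge = ⊥-elim (¬injective (edge⇒injective ι edge))
      ... | no _ = ≈-refl

-- Hypergraphs whose edges are complements of single vertices

module CoSingleton {d s : ℕ}
  (_∈ₑ_ : Fin (suc (suc d)) → Fin s → Set)
  (gap : Fin s → Fin (suc (suc d)))
  (∈ₑ⇔≢gap : ∀ v e → v ∈ₑ e ⇔ v ≢ gap e)
  (e₀ : Fin s)
  where

  H : Hypergraph (suc (suc d))
  H = record { EdgeIx = Fin s ; _∈ₑ_ = _∈ₑ_ }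

  L : Fin (suc (suc d))
  L = gap e₀

  ∈E⇔complement : ∀ {X} → X ∈E H ⇔ (∃[ e ] ∀ v → X v ⇔ v ≢ gap e)
  ∈E⇔complement = mk⇔
    (λ (e , X⇔e) → e , λ v → ⇔.trans (X⇔e v) (∈ₑ⇔≢gap v e))
    (λ (e , X⇔≢) → e , λ v → ⇔.trans (X⇔≢ v) (⇔.sym (∈ₑ⇔≢gap v e)))

  _∈ₑ?_ : ∀ v e → Dec (v ∈ₑ e)
  v ∈ₑ? e = Dec.map (⇔.sym (∈ₑ⇔≢gap v e)) (¬? (v Fin.≟ gap e))

  edge? : ∀ (ι : Fin (suc d) → Fin (suc (suc d))) → Dec (image ι ∈E H)
  edge? ι = Fin.any? λ e → Fin.all? λ v → Fin.any? (λ p → ι p Fin.≟ v) ⇔? (v ∈ₑ? e)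

  edge⇒injective : ∀ (ι : Fin (suc d) → Fin (suc (suc d))) → image ι ∈E H → Injective _≡_ _≡_ ι
  edge⇒injective ι edge =
    ontoComplement⇒injective ι (gap e) (λ v → from (image⇔≢g v))
    where
    e = proj₁ (to ∈E⇔complement edge)
    image⇔≢g = proj₂ (to ∈E⇔complement edge)

  ForcingStep : Subset (suc (suc d)) → Subset (suc (suc d)) → Set
  ForcingStep = Step (suc d) H

  L-forces : ∀ {C w} → L ∈ C → w ∉ C → Forces (suc d) H C (∁ (⁅ w ⁆ ∪ ⁅ L ⁆)) w
  L-forces {C} {w} L∈C w∉C =
    ∣S∣≡d , w∉C , from ∈E⇔complement (e₀ , S∪w⇔≢L) , onlyW
    where
    S = ∁ (⁅ w ⁆ ∪ ⁅ L ⁆)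
    w≢L : w ≢ L
    w≢L w≡L = w∉C (subst (_∈ C) (sym w≡L) L∈C)
    ∣S∣≡d : ∣ S ∣ ≡ d
    ∣S∣≡d = trans (∣∁p∣≡n∸∣p∣ (⁅ w ⁆ ∪ ⁅ L ⁆)) (cong (suc (suc d) ∸_) (∣⁅x⁆∪⁅y⁆∣≡2 w≢L))
    S∪w⇔≢L : ∀ v → (v ∈ S ⊎ v ≡ w) ⇔ v ≢ L
    S∪w⇔≢L v = mk⇔ [ proj₂ ∘ to x∈∁⁅y⁆∪⁅z⁆⇔ , (λ v≡w → subst (_≢ L) (sym v≡w) w≢L) ] into
      where
      into : v ≢ L → v ∈ S ⊎ v ≡ w
      into v≢L with v Fin.≟ w
      ... | yes v≡w = inj₂ v≡w
      ... | no v≢w = inj₁ (from x∈∁⁅y⁆∪⁅z⁆⇔ (v≢w , v≢L))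
    onlyW : ∀ u → u ∉ C → (λ v → v ∈ S ⊎ v ≡ u) ∈E H → u ≡ w
    onlyW u u∉C S∪u∈E with u Fin.≟ w | to ∈E⇔complement S∪u∈E
    ... | yes u≡w | _ = u≡w
    ... | no u≢w | e , S∪u⇔≢g = contradiction (trans (isGap w≢u w∉S) (sym (isGap L≢u L∉S))) w≢L
      where
      isGap : ∀ {v} → v ≢ u → v ∉ S → v ≡ gap e
      isGap v≢u v∉S = decidable-stable (_ Fin.≟ gap e)
        (λ v≢g → [ v∉S , v≢u ] (from (S∪u⇔≢g _) v≢g))
      w≢u : w ≢ u
      w≢u = u≢w ∘ sym
      L≢u : L ≢ u
      L≢u L≡u = u∉C (subst (_∈ C) L≡u L∈C)
      w∉S : w ∉ S
      w∉S w∈S = proj₁ (to x∈∁⁅y⁆∪⁅z⁆⇔ w∈S) refl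
      L∉S : L ∉ S
      L∉S L∈S = proj₂ (to x∈∁⁅y⁆∪⁅z⁆⇔ L∈S) refl

  insertAll-reachable : ∀ {C} xs → L ∈ C → Star ForcingStep C (insertAll C xs)
  insertAll-reachable [] _ = ε
  insertAll-reachable {C} (w ∷ xs) L∈C = addW ◅◅ insertAll-reachable xs (p⊆p∪q ⁅ w ⁆ L∈C)
    where
    addW : Star ForcingStep C (C ∪ ⁅ w ⁆)
    addW with w ∈? C
    ... | yes w∈C = subst (Star ForcingStep C) (sym (x∈p⇒p∪⁅x⁆≡p w∈C)) ε
    ... | no w∉C = (_ , w , L-forces L∈C w∉C , refl) ◅ ε

  ⁅L⁆-zeroForcing : ZeroForcingSet (suc d) H ⁅ L ⁆
  ⁅L⁆-zeroForcing = subst (Star ForcingStep ⁅ L ⁆) (insertAll-allFin ⁅ L ⁆)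
    (insertAll-reachable (allFin _) (x∈⁅x⁆ L))

  GapFree : Subset (suc (suc d)) → Set
  GapFree C = ∀ e → gap e ∉ C

  forced⇒≢gap : ∀ {C S w} → GapFree C → Forces (suc d) H C S w → ∀ e′ → w ≢ gap e′
  forced⇒≢gap {C} {S} {w} C-gapFree (∣S∣≡d , _ , S∪w∈E , onlyW) e′ w≡gap
    with to ∈E⇔complement S∪w∈E | w ∈? S
  ... | e , S∪w⇔≢g | yes w∈S =
    ℕ.1+n≰n (subst₂ _≤_ ∣∁⁅g⁆∣≡1+d ∣S∣≡d (p⊆q⇒∣p∣≤∣q∣ ∁⁅g⁆⊆S))
    where
    ∁⁅g⁆⊆S : ∁ ⁅ gap e ⁆ ⊆ S
    ∁⁅g⁆⊆S {v} v∈∁ = [ id , (λ v≡w → subst (_∈ S) (sym v≡w) w∈S) ]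
      (from (S∪w⇔≢g v) (x∉⁅y⁆⇒x≢y (x∈∁p⇒x∉p v∈∁)))
    ∣∁⁅g⁆∣≡1+d : ∣ ∁ ⁅ gap e ⁆ ∣ ≡ suc d
    ∣∁⁅g⁆∣≡1+d = trans (∣∁p∣≡n∸∣p∣ ⁅ gap e ⁆) (cong (suc (suc d) ∸_) (∣⁅x⁆∣≡1 (gap e)))
  ... | e , S∪w⇔≢g | no w∉S = w≢g (sym (onlyW (gap e) (C-gapFree e) S∪g∈E))
    where
    w≢g : w ≢ gap e
    w≢g = to (S∪w⇔≢g w) (inj₂ refl)
    S∪g⇔≢w : ∀ v → (v ∈ S ⊎ v ≡ gap e) ⇔ v ≢ w
    S∪g⇔≢w v = mk⇔
      [ (λ v∈S v≡w → w∉S (subst (_∈ S) v≡w v∈S)) , (λ v≡g v≡w → w≢g (trans (sym v≡w) v≡g)) ]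
      into
      where
      into : v ≢ w → v ∈ S ⊎ v ≡ gap e
      into v≢w with v Fin.≟ gap e
      ... | yes v≡g = inj₂ v≡g
      ... | no v≢g = [ inj₁ , (λ v≡w → contradiction v≡w v≢w) ] (from (S∪w⇔≢g v) v≢g)
    S∪g∈E : (λ v → v ∈ S ⊎ v ≡ gap e) ∈E H
    S∪g∈E = from ∈E⇔complement (e′ , subst (λ u → ∀ v → _ ⇔ v ≢ u) w≡gap S∪g⇔≢w)

  reachable-gapFree : ∀ {C C′} → GapFree C → Star ForcingStep C C′ → GapFree C′
  reachable-gapFree C-gapFree ε = C-gapFree
  reachable-gapFree C-gapFree ((_ , w , forces , refl) ◅ steps) = reachable-gapFree
    (λ e → [ C-gapFree e , (λ g∈⁅w⁆ → forced⇒≢gap C-gapFree forces e (sym (x∈⁅y⁆⇒x≡y w g∈⁅w⁆))) ]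
           ∘ x∈p∪q⁻ _ ⁅ w ⁆)
    steps

  zeroForcing⇒nonempty : ∀ B → ZeroForcingSet (suc d) H B → 1 ≤ ∣ B ∣
  zeroForcing⇒nonempty B B-forcing with nonempty? B
  ... | yes (x , x∈B) = subst (_≤ ∣ B ∣) (∣⁅x⁆∣≡1 x)
    (p⊆q⇒∣p∣≤∣q∣ (λ y∈⁅x⁆ → subst (_∈ B) (sym (x∈⁅y⁆⇒x≡y x y∈⁅x⁆)) x∈B))
  ... | no empty = ⊥-elim (reachable-gapFree (λ e g∈B → empty (gap e , g∈B)) B-forcing e₀ ∈⊤)

  Z₀≡1 : IsZ₀ (suc d) H 1
  Z₀≡1 = (⁅ L ⁆ , ∣⁅x⁆∣≡1 L , ⁅L⁆-zeroForcing) , zeroForcing⇒nonempty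

  module _ {c ℓ} (F : Field c ℓ) where
    open Field F
      renaming (refl to ≈-refl; sym to ≈-sym; trans to ≈-trans; reflexive to ≈-reflexive)
    open import Algebra.Definitions.RawMonoid +-rawMonoid using (sum)
    open import Relation.Binary.Reasoning.Setoid setoid

    S-nonempty : SNonempty F (suc d) H
    S-nonempty = indicator F H edge? edge⇒injective , indicator∈S F H edge? edge⇒injective

    last : Fin (suc d)
    last = fromℕ d

    -- probe j k lists every vertex except L and punchIn L j, followed by k.
    probe : Fin (suc d) → Fin (suc (suc d)) → Fin (suc d) → Fin (suc (suc d))
    probe j = replaceAt F (insertAt (punchIn L ∘ punchIn j) last L) last

    probe-last : ∀ j k → probe j k last ≡ k
    probe-last j = replaceAt-at F _ last

    probe-punchIn : ∀ j k c → probe j k (punchIn last c) ≡ punchIn L (punchIn j c)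
    probe-punchIn j k c = trans (replaceAt-punchIn F _ last k c)
      (insertAt-punchIn (punchIn L ∘ punchIn j) last L c)

    probe-nonInjective : ∀ j c → ¬ Injective _≡_ _≡_ (probe j (punchIn L (punchIn j c)))
    probe-nonInjective j c injective =
      Fin.punchInᵢ≢i last c (injective (trans (probe-punchIn j _ c) (sym (probe-last j _))))

    probe-image : ∀ j v → image (probe j (punchIn L j)) v ⇔ v ≢ L
    probe-image j v = mk⇔ (λ (q , q↦v) → subst (_≢ L) q↦v (avoidsL q)) (coversL v)
      where
      τ = probe j (punchIn L j)
      avoidsL : ∀ q → τ q ≢ L
      avoidsL = ∀-punchIn (λ q → τ q ≢ L) last
        (subst (_≢ L) (sym (probe-last j _)) (Fin.punchInᵢ≢i L j))
        (λ c → subst (_≢ L) (sym (probe-punchIn j _ c)) (Fin.punchInᵢ≢i L _))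
      coversL : ∀ v → v ≢ L → image τ v
      coversL = ∀-punchIn (λ v → v ≢ L → image τ v) L (λ L≢L → contradiction refl L≢L)
        (λ w _ → ∀-punchIn (λ w → image τ (punchIn L w)) j
          (last , probe-last j _)
          (λ c → punchIn last c , probe-punchIn j _ c) w)

    module _ (A : Hypermatrix F (suc d) (suc (suc d))) (A∈S : InS F H A) where

      coefficientL coefficient : Fin (suc d) → Carrier
      coefficientL j = A (probe j L)
      coefficient j = A (probe j (punchIn L j))

      coefficient≉0 : ∀ j → ¬ (coefficient j ≈ 0#)
      coefficient≉0 j = from (proj₂ A∈S (probe j (punchIn L j)))
        (from ∈E⇔complement (e₀ , probe-image j))

      null⇒relation : ∀ {x} → NullVector F A x → ∀ j →
        coefficientL j * x L + coefficient j * x (punchIn L j) ≈ 0#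
      null⇒relation {x} x-null j = begin
        coefficientL j * x L + coefficient j * x (punchIn L j)  ≈⟨ sum-twoTerms F summand L j vanishes ⟨
        sum summand                                             ≈⟨ x-null _ last (Fin.toℕ-fromℕ d) ⟩
        0#                                                      ∎
        where
        summand : Fin (suc (suc d)) → Carrier
        summand k = A (probe j k) * x k
        vanishes : ∀ c → summand (punchIn L (punchIn j c)) ≈ 0#
        vanishes c = ≈-trans (*-congʳ (proj₂ (proj₁ A∈S) _ (probe-nonInjective j c))) (zeroˡ _)

      direction : Fin (suc (suc d)) → Carrier
      direction = insertAt
        (λ j → - (coefficientL j * proj₁ (inverse (coefficient j) (coefficient≉0 j)))) L 1#

      null⇒collinear : ∀ {x} → NullVector F A x → ∀ v → x v ≈ x L * direction v
      null⇒collinear {x} x-null = ∀-punchIn (λ v → x v ≈ x L * direction v) L atL atPunchIn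
        where
        atL : x L ≈ x L * direction L
        atL = begin
          x L        ≈⟨ *-identityʳ (x L) ⟨
          x L * 1#   ≈⟨ *-congˡ (≈-reflexive (insertAt-lookup _ L 1#)) ⟨
          x L * direction L ∎
        atPunchIn : ∀ j → x (punchIn L j) ≈ x L * direction (punchIn L j)
        atPunchIn j = begin
          x (punchIn L j)  ≈⟨ solve-linear F (null⇒relation {x} x-null j) (proj₂ (inverse _ (coefficient≉0 j))) ⟩
          _ * x L          ≈⟨ *-comm _ (x L) ⟩
          x L * _          ≈⟨ *-congˡ (≈-reflexive (insertAt-punchIn _ L 1# j)) ⟨
          x L * direction (punchIn L j) ∎

    maxNullity≤1 : MaxNullityAtMost F (suc d) H 1
    maxNullity≤1 A A∈S v v-null =
      collinear⇒≤1 F v (λ i → v i L) (direction A A∈S) (λ i → null⇒collinear A A∈S (v-null i))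

-- Circular arcs

open import Data.Nat using (_+_; _*_)

ArcMember : (n d a v : ℕ) → Set
ArcMember n d a v = ∃[ k ] (k < d × ((v ≡ a + k) ⊎ (v + n ≡ a + k)))

-- The cycle length n is kept separate from s * D so that circArc d t s is
-- arcs (s * (d ∸ t)) d (d ∸ t) s definitionally, while n can still be matched against d + 1.
arcs : (n d D s : ℕ) → Hypergraph n
arcs n d D s = record
  { EdgeIx = Fin s
  ; _∈ₑ_ = λ v i → ArcMember n d (toℕ i * D) (toℕ v)
  }

-- a + d modulo d + 1: the one vertex of the (d+1)-cycle that the arc of length d from a misses.
arcGap : ℕ → ℕ → ℕ
arcGap d zero    = d
arcGap d (suc a) = a

arcGap<1+d : ∀ {d a} → a ≤ d → arcGap d a < suc d
arcGap<1+d {a = zero}  _   = ℕ.≤-refl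
arcGap<1+d {a = suc a} a<d = ℕ.m<n⇒m<1+n a<d

arcMember⇒≢arcGap : ∀ {d} a {v} → ArcMember (suc d) d a v → v ≢ arcGap d a
arcMember⇒≢arcGap zero (k , k<d , inj₁ d≡k) refl = ℕ.<-irrefl (sym d≡k) k<d
arcMember⇒≢arcGap {d} zero (k , k<d , inj₂ d+1+d≡k) refl =
  ℕ.<-asym k<d (subst (d <_) d+1+d≡k (ℕ.m≤n+m (suc d) d))
arcMember⇒≢arcGap (suc a) (k , _ , inj₁ a≡1+a+k) refl = ℕ.m≢1+m+n a a≡1+a+k
arcMember⇒≢arcGap {d} (suc a) (k , k<d , inj₂ a+1+d≡1+a+k) refl = ℕ.<-irrefl k≡d k<d
  where
  k≡d : k ≡ d
  k≡d = ℕ.+-cancelˡ-≡ a k d (ℕ.suc-injective (trans (sym a+1+d≡1+a+k) (ℕ.+-suc a d)))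

≢arcGap⇒arcMember : ∀ {d} a {v} → a ≤ d → v ≤ d → v ≢ arcGap d a → ArcMember (suc d) d a v
≢arcGap⇒arcMember zero _ v≤d v≢d = _ , ℕ.≤∧≢⇒< v≤d v≢d , inj₁ refl
≢arcGap⇒arcMember {d} (suc a) {v} a<d v≤d v≢a with suc a ℕ.≤? v
... | yes a<v = v ∸ suc a , k<d , inj₁ (sym (ℕ.m+[n∸m]≡n a<v))
  where
  k<d : v ∸ suc a < d
  k<d = ℕ.≤-trans (s≤s (ℕ.m≤n+m (v ∸ suc a) a)) (subst (_≤ d) (sym (ℕ.m+[n∸m]≡n a<v)) v≤d)
... | no a≮v = k , k<d , inj₂ (sym (ℕ.m+[n∸m]≡n a<v+1+d))
  where
  k = v + suc d ∸ suc a
  a<v+1+d : suc a ≤ v + suc d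
  a<v+1+d = ℕ.≤-trans a<d (ℕ.≤-trans (ℕ.n≤1+n d) (ℕ.m≤n+m (suc d) v))
  v<a : v < a
  v<a = ℕ.≤∧≢⇒< (ℕ.≤-pred (ℕ.≰⇒> a≮v)) v≢a
  k<d : k < d
  k<d = ℕ.+-cancelˡ-< (suc a) k d (subst (_< suc a + d)
    (trans (sym (ℕ.+-suc v d)) (sym (ℕ.m+[n∸m]≡n a<v+1+d))) (s≤s (ℕ.+-monoˡ-< d v<a)))

arcStart≤ : ∀ {d D s} (i : Fin s) → s * D ≡ suc d → toℕ i * D ≤ d
arcStart≤ {d} {zero} i _ = subst (_≤ d) (sym (ℕ.*-zeroʳ (toℕ i))) z≤n
arcStart≤ {d} {suc D} i s*D≡1+d = ℕ.≤-pred (ℕ.≤-trans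
  (s≤s (ℕ.m≤n+m (toℕ i * suc D) D))
  (subst (suc (toℕ i) * suc D ≤_) s*D≡1+d (ℕ.*-monoˡ-≤ (suc D) (Fin.toℕ<n i))))

module _ {c ℓ} (F : Field c ℓ) where

  arcs-properties : ∀ {n} d D s → s * D ≡ suc (suc d) → n ≡ suc (suc d) →
    SNonempty F (suc d) (arcs n (suc d) D s)
    × MaxNullityAtMost F (suc d) (arcs n (suc d) D s) 1
    × IsZ₀ (suc d) (arcs n (suc d) D s) 1
  arcs-properties d D (suc s) s*D≡2+d refl =
    S-nonempty F , maxNullity≤1 F , Z₀≡1
    where
    gap : Fin (suc s) → Fin (suc (suc d))
    gap i = fromℕ< (arcGap<1+d (arcStart≤ i s*D≡2+d))
    toℕ-gap : ∀ i → toℕ (gap i) ≡ arcGap (suc d) (toℕ i * D)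
    toℕ-gap i = Fin.toℕ-fromℕ< (arcGap<1+d (arcStart≤ i s*D≡2+d))
    ∈ₑ⇔≢gap : ∀ v i → ArcMember (suc (suc d)) (suc d) (toℕ i * D) (toℕ v) ⇔ v ≢ gap i
    ∈ₑ⇔≢gap v i = mk⇔
      (λ member v≡g → arcMember⇒≢arcGap (toℕ i * D) member (trans (cong toℕ v≡g) (toℕ-gap i)))
      (λ v≢g → ≢arcGap⇒arcMember (toℕ i * D) (arcStart≤ i s*D≡2+d) (Fin.toℕ≤pred[n] v)
        (λ v≡g → v≢g (Fin.toℕ-injective (trans v≡g (sym (toℕ-gap i))))))
    open CoSingleton (λ v i → ArcMember (suc (suc d)) (suc d) (toℕ i * D) (toℕ v)) gap ∈ₑ⇔≢gap fz

proposition3p16 : ∀ {c ℓ : Level} (F : Field c ℓ) (d t s : ℕ) →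
    3 ≤ d → 1 ≤ t → t ≤ d ∸ 1 →
    s * (d ∸ t) ≡ suc d →
    SNonempty F d (circArc d t s)
    × MaxNullityAtMost F d (circArc d t s) 1
    × IsZ₀ d (circArc d t s) 1
proposition3p16 F zero    t s ()
proposition3p16 F (suc d) t s _ _ _ s*D≡1+d = arcs-properties F d (suc d ∸ t) s s*D≡1+d s*D≡1+d
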